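{- Let $X$ be a finite set and let $\mathcal{F}\subset 2^X$ be a weakly-$k$-cross-free intersecting family. Then $\mathcal{F}$ can be partitioned into $k-1$ chains.
   Context: Two sets $A,B\subset X$ are weakly-crossing if none of the three sets $A\cap B$, $A\setminus B$, $B\setminus A$ is empty. A family is weakly-$k$-cross-free if it does not contain $k$ pairwise weakly-crossing members. A family is intersecting if any two of its members have nonempty intersection. A chain is a family any two members of which are comparable under inclusion. -}

module Defs where

open import Data.Nat using (ℕ)
open import Data.Fin using (Fin)
open import Data.Fin.Subset using (Subset; _⊆_; _∩_; _─_; Nonempty)
open import Data.List using (List; length; lookup)
open import Data.Product using (_×_; ∃)
open import Data.Sum using (_⊎_)
open import Relation.Binary.PropositionalEquality using (_≡_)
open import Relation.Nullary using (¬_)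
open import Data.List.Membership.Propositional using (_∈_)
open import Function.Definitions using (Injective)

-- Ground set X = Fin n; subsets of X are Subset n.
-- A family F ⊆ 2^X is given as a duplicate-free list of subsets.

WeaklyCrossing : ∀ {n} → Subset n → Subset n → Set
WeaklyCrossing A B = Nonempty (A ∩ B) × Nonempty (A ─ B) × Nonempty (B ─ A)

HasWeaklyCrossingK : ∀ {n} → ℕ → List (Subset n) → Set
HasWeaklyCrossingK {n} k F =
  ∃ λ (S : Fin k → Subset n) →
    Injective _≡_ _≡_ S ×
    (∀ i → S i ∈ F) ×
    (∀ i j → ¬ (i ≡ j) → WeaklyCrossing (S i) (S j))

WeaklyKCrossFree : ∀ {n} → ℕ → List (Subset n) → Set
WeaklyKCrossFree k F = ¬ HasWeaklyCrossingK k F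

Intersecting : ∀ {n} → List (Subset n) → Set
Intersecting F = ∀ A B → A ∈ F → B ∈ F → Nonempty (A ∩ B)

Comparable : ∀ {n} → Subset n → Subset n → Set
Comparable A B = A ⊆ B ⊎ B ⊆ A

-- F can be partitioned into m chains: each member (position in the list)
-- gets a colour in Fin m, and members of equal colour are comparable.
-- (Some of the m chains may be empty.)
PartitionIntoChains : ∀ {n} → ℕ → List (Subset n) → Set
PartitionIntoChains m F =
  ∃ λ (c : Fin (length F) → Fin m) →
    ∀ i j → c i ≡ c j → Comparable (lookup F i) (lookup F j)

-- In an intersecting family two members weakly cross exactly when they are
-- incomparable, so a weakly-k-cross-free intersecting family is a poset
-- (under ⊆) without antichains of size k, and Dilworth's theorem covers it by
-- k − 1 chains. Dilworth's theorem is proved following Galvin: remove a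
-- maximal element a, chain-cover the rest, and if the rest already has a
-- maximum-size antichain, take in each chain C the largest element x that lies
-- on such an antichain. These x form an antichain; either it extends by a, or
-- some x ≼ a, and then {a} ∪ {z ∈ C ∣ z ≼ x} is a chain meeting every
-- maximum-size antichain, whose removal lowers the width.
module Submission where

open import Defs hiding (Comparable)
open import Level using (_⊔_)
open import Data.Nat using (ℕ; zero; suc; _∸_; _<_; _≤_)
import Data.Nat.Properties as ℕ
open import Data.Nat.Induction using (<-wellFounded)
open import Data.Fin using (Fin; zero; suc; toℕ; fromℕ<; punchIn; punchOut)
import Data.Fin as Fin
open import Data.Fin.Properties
  using (any?; injective⇒≤; punchOut-injective; punchIn-injective; punchInᵢ≢i; toℕ-fromℕ<; toℕ-injective)
open import Data.Fin.Subset using (Subset; _⊆_; _─_; Nonempty)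
open import Data.Fin.Subset.Properties using (_⊆?_; ⊆-isPartialOrder; nonempty?; x∈p∧x∉q⇒x∈p─q)
import Data.Fin.Subset.Properties as Subsetₚ
open import Data.Vec.Properties using (≡-dec)
import Data.Bool.Properties as Bool
open import Data.List using (List; []; _∷_; length; filter)
open import Data.List.Properties using (length-filter; filter-notAll)
open import Data.List.Relation.Unary.Unique.Propositional using (Unique)
import Data.List.Relation.Unary.Any as Any
open import Data.List.Relation.Unary.Any using (here; there)
open import Data.List.Membership.Propositional using (_∈_)
open import Data.List.Membership.Propositional.Properties using (∈-filter⁺; ∈-filter⁻; ∈-lookup)
open import Data.Product using (Σ; ∃; _×_; _,_; proj₁; proj₂)
open import Data.Sum using (_⊎_; inj₁; inj₂; [_,_]′)
open import Data.Empty using (⊥-elim)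
open import Function using (_∘_)
open import Function.Definitions using (Injective)
open import Induction.WellFounded using (module All)
open import Relation.Binary using (Rel; IsDecPartialOrder)
import Relation.Binary.Construct.On as On
open import Relation.Binary.PropositionalEquality
open import Relation.Nullary using (¬_; Dec; yes; no; ¬?; contradiction)
open import Relation.Nullary.Decidable using (_×-dec_; _⊎-dec_; decidable-stable; map′)
open import Relation.Unary using (Pred; Decidable)
open import Relation.Unary.Properties using (∁?)

injective⇒surjective : ∀ {n} {f : Fin n → Fin n} → Injective _≡_ _≡_ f →
                        ∀ j → ∃ λ i → f i ≡ j
injective⇒surjective {suc n} {f} f-injective j with any? (λ i → f i Fin.≟ j)
... | yes hit = hit
... | no miss = contradiction (injective⇒≤ {f = g} g-injective) ℕ.1+n≰n
  where
  j≢f : ∀ i → j ≢ f i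
  j≢f i j≡fi = miss (i , sym j≡fi)

  g : Fin (suc n) → Fin n
  g i = punchOut (j≢f i)

  g-injective : Injective _≡_ _≡_ g
  g-injective {i} {i′} = f-injective ∘ punchOut-injective (j≢f i) (j≢f i′)

filter-shorter : ∀ {a p} {A : Set a} {K : Pred A p} (K? : Decidable K) {x} {L : List A} →
                 x ∈ L → K x → length (filter (∁? K?) L) < length L
filter-shorter K? x∈L Kx = filter-notAll (∁? K?) _ (Any.map (λ { refl ¬Kx → ¬Kx Kx }) x∈L)

module Dilworth {c ℓ} {A : Set c} {_≼_ : Rel A ℓ}
                (isDecPartialOrder : IsDecPartialOrder _≡_ _≼_) where

  open IsDecPartialOrder isDecPartialOrder
    renaming (refl to ≼-refl; trans to ≼-trans; antisym to ≼-antisym; _≤?_ to _≼?_)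
  open import Data.List.Membership.DecPropositional _≟_ using (_∈?_)

  Comparable : A → A → Set ℓ
  Comparable x y = x ≼ y ⊎ y ≼ x

  Incomparable : A → A → Set ℓ
  Incomparable x y = ¬ x ≼ y × ¬ y ≼ x

  incomparable? : ∀ x y → Dec (Incomparable x y)
  incomparable? x y = ¬? (x ≼? y) ×-dec ¬? (y ≼? x)

  record Antichain (P : List A) (k : ℕ) : Set (c ⊔ ℓ) where
    field
      elem         : Fin k → A
      elem∈        : ∀ i → elem i ∈ P
      incomparable : ∀ {i j} → i ≢ j → ¬ elem i ≼ elem j

    comparable⇒≡ : ∀ {i j} → Comparable (elem i) (elem j) → i ≡ j
    comparable⇒≡ {i} {j} i~j with i Fin.≟ j
    ... | yes i≡j = i≡j
    ... | no i≢j  = ⊥-elim ([ incomparable i≢j , incomparable (i≢j ∘ sym) ]′ i~j)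

    elem-injective : Injective _≡_ _≡_ elem
    elem-injective elemᵢ≡elemⱼ = comparable⇒≡ (inj₁ (reflexive elemᵢ≡elemⱼ))

  open Antichain

  record ChainColouring (P : List A) (m : ℕ) : Set (c ⊔ ℓ) where
    field
      colour                   : A → ℕ
      colour<                  : ∀ {x} → x ∈ P → colour x < m
      monochromatic⇒comparable : ∀ {x y} → x ∈ P → y ∈ P → colour x ≡ colour y → Comparable x y

    colourᶠ : ∀ {x} → x ∈ P → Fin m
    colourᶠ x∈P = fromℕ< (colour< x∈P)

    colourᶠ≡⇒colour≡ : ∀ {x y} (x∈P : x ∈ P) (y∈P : y ∈ P) →
                       colourᶠ x∈P ≡ colourᶠ y∈P → colour x ≡ colour y
    colourᶠ≡⇒colour≡ {x} {y} x∈P y∈P eq = begin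
      colour x         ≡⟨ toℕ-fromℕ< (colour< x∈P) ⟨
      toℕ (colourᶠ x∈P) ≡⟨ cong toℕ eq ⟩
      toℕ (colourᶠ y∈P) ≡⟨ toℕ-fromℕ< (colour< y∈P) ⟩
      colour y         ∎
      where open ≡-Reasoning

  open ChainColouring

  AntichainOrChainCover : List A → ℕ → Set (c ⊔ ℓ)
  AntichainOrChainCover P m = Antichain P (suc m) ⊎ ChainColouring P m

  emptyAntichain : ∀ {P} → Antichain P 0
  emptyAntichain = record { elem = λ () ; elem∈ = λ () ; incomparable = λ { {()} } }

  singletonAntichain : ∀ {P x} → x ∈ P → Antichain P 1
  singletonAntichain {x = x} x∈P = record
    { elem = λ _ → x ; elem∈ = λ _ → x∈P ; incomparable = λ { {zero} {zero} 0≢0 → ⊥-elim (0≢0 refl) } }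

  antichain-mono : ∀ {P P' k} → (∀ {z} → z ∈ P → z ∈ P') → Antichain P k → Antichain P' k
  antichain-mono P⊆P' S = record { elem = elem S ; elem∈ = P⊆P' ∘ elem∈ S ; incomparable = incomparable S }

  antichain-cons : ∀ {P k y} → y ∈ P → (S : Antichain P k) → (∀ i → Incomparable y (elem S i)) →
                   Antichain P (suc k)
  antichain-cons {P} {k} {y} y∈P S y∥S =
    record { elem = elem′ ; elem∈ = elem∈′ ; incomparable = incomparable′ }
    where
    elem′ : Fin (suc k) → A
    elem′ zero    = y
    elem′ (suc i) = elem S i

    elem∈′ : ∀ i → elem′ i ∈ P
    elem∈′ zero    = y∈P
    elem∈′ (suc i) = elem∈ S i

    incomparable′ : ∀ {i j} → i ≢ j → ¬ elem′ i ≼ elem′ j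
    incomparable′ {zero}  {zero}  0≢0 = ⊥-elim (0≢0 refl)
    incomparable′ {zero}  {suc j} _   = proj₁ (y∥S j)
    incomparable′ {suc i} {zero}  _   = proj₂ (y∥S i)
    incomparable′ {suc i} {suc j} i≢j = incomparable S (i≢j ∘ cong suc)

  colourᶠ∘elem-injective : ∀ {P m k} (C : ChainColouring P m) (S : Antichain P k) →
                           Injective _≡_ _≡_ (colourᶠ C ∘ elem∈ S)
  colourᶠ∘elem-injective C S {i} {j} =
    comparable⇒≡ S ∘ monochromatic⇒comparable C (elem∈ S i) (elem∈ S j)
                   ∘ colourᶠ≡⇒colour≡ C (elem∈ S i) (elem∈ S j)

  antichain≤colours : ∀ {P m k} → ChainColouring P m → Antichain P k → k ≤ m
  antichain≤colours C S = injective⇒≤ (colourᶠ∘elem-injective C S)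

  colouring⇒¬antichain : ∀ {P m} → ChainColouring P m → ¬ Antichain P (suc m)
  colouring⇒¬antichain C S = ℕ.1+n≰n (antichain≤colours C S)

  antichain-meets-colour : ∀ {P m} (C : ChainColouring P m) (S : Antichain P m) (i : Fin m) →
                           ∃ λ p → colour C (elem S p) ≡ toℕ i
  antichain-meets-colour C S i with injective⇒surjective (colourᶠ∘elem-injective C S) i
  ... | p , colourᶠ≡i = p , trans (sym (toℕ-fromℕ< (colour< C (elem∈ S p)))) (cong toℕ colourᶠ≡i)

  add-chain : ∀ {p P m} {K : Pred A p} (K? : Decidable K) →
              (∀ {x y} → x ∈ P → y ∈ P → K x → K y → Comparable x y) →
              ChainColouring (filter (∁? K?) P) m → ChainColouring P (suc m)
  add-chain {P = P} {m} {K} K? K-chain C = record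
    { colour = colour′ ; colour< = colour<′ ; monochromatic⇒comparable = monochromatic′ }
    where
    colour′ : A → ℕ
    colour′ z with K? z
    ... | yes _ = m
    ... | no _  = colour C z

    rest∈ : ∀ {z} → z ∈ P → ¬ K z → z ∈ filter (∁? K?) P
    rest∈ = ∈-filter⁺ (∁? K?)

    colour<′ : ∀ {z} → z ∈ P → colour′ z < suc m
    colour<′ {z} z∈P with K? z
    ... | yes _  = ℕ.n<1+n m
    ... | no ¬Kz = ℕ.m<n⇒m<1+n (colour< C (rest∈ z∈P ¬Kz))

    monochromatic′ : ∀ {x y} → x ∈ P → y ∈ P → colour′ x ≡ colour′ y → Comparable x y
    monochromatic′ {x} {y} x∈P y∈P eq with K? x | K? y
    ... | yes Kx  | yes Ky  = K-chain x∈P y∈P Kx Ky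
    ... | yes _   | no ¬Ky  = ⊥-elim (ℕ.<⇒≢ (colour< C (rest∈ y∈P ¬Ky)) (sym eq))
    ... | no ¬Kx  | yes _   = ⊥-elim (ℕ.<⇒≢ (colour< C (rest∈ x∈P ¬Kx)) eq)
    ... | no ¬Kx  | no ¬Ky  = monochromatic⇒comparable C (rest∈ x∈P ¬Kx) (rest∈ y∈P ¬Ky) eq

  Maximal : List A → A → Set (c ⊔ ℓ)
  Maximal L x = x ∈ L × (∀ {y} → y ∈ L → x ≼ y → y ≡ x)

  maximal-∷ : ∀ x L → ∃ (Maximal (x ∷ L))
  maximal-∷ x []      = x , here refl , λ { (here y≡x) _ → y≡x }
  maximal-∷ x (y ∷ L) with maximal-∷ y L
  ... | b , b∈ , b-max with b ≼? x
  ...   | yes b≼x = x , here refl , x-max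
    where
    x-max : ∀ {z} → z ∈ x ∷ y ∷ L → x ≼ z → z ≡ x
    x-max (here z≡x) _   = z≡x
    x-max (there z∈) x≼z with b-max z∈ (≼-trans b≼x x≼z)
    ... | refl = ≼-antisym b≼x x≼z
  ...   | no b⋠x = b , there b∈ , b-max′
    where
    b-max′ : ∀ {z} → z ∈ x ∷ y ∷ L → b ≼ z → z ≡ b
    b-max′ (here refl) b≼x = ⊥-elim (b⋠x b≼x)
    b-max′ (there z∈)  b≼z = b-max z∈ b≼z

  maximal : ∀ {L z} → z ∈ L → ∃ (Maximal L)
  maximal {x ∷ L} _ = maximal-∷ x L

  OnAntichain : List A → ℕ → A → Set (c ⊔ ℓ)
  OnAntichain Q k y = Σ (Antichain Q k) λ T → ∃ λ p → elem T p ≡ y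

  incomparables : A → List A → List A
  incomparables y = filter (incomparable? y)

  onAntichain-suc : ∀ {Q k y} → y ∈ Q → Antichain (incomparables y Q) k → OnAntichain Q (suc k) y
  onAntichain-suc {Q} {y = y} y∈Q S =
    antichain-cons y∈Q (antichain-mono (proj₁ ∘ ∈-filter⁻ (incomparable? y) {xs = Q}) S)
                   (proj₂ ∘ ∈-filter⁻ (incomparable? y) {xs = Q} ∘ elem∈ S) ,
    zero , refl

  onAntichain-pred : ∀ {Q k y} → OnAntichain Q (suc k) y → Antichain (incomparables y Q) k
  onAntichain-pred (T , p , refl) = record
    { elem         = elem T ∘ punchIn p
    ; elem∈        = λ i → ∈-filter⁺ (incomparable? _) (elem∈ T (punchIn p i))
                             (incomparable T (punchInᵢ≢i p i ∘ sym) , incomparable T (punchInᵢ≢i p i))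
    ; incomparable = λ i≢j → incomparable T (i≢j ∘ punchIn-injective p _ _)
    }

  onAntichain? : ∀ {Q k} → (∀ y → Dec (Antichain (incomparables y Q) k)) → Decidable (OnAntichain Q (suc k))
  onAntichain? {Q} antichain? y with y ∈? Q
  ... | yes y∈Q = map′ (onAntichain-suc y∈Q) onAntichain-pred (antichain? y)
  ... | no y∉Q  = no λ { (T , p , refl) → y∉Q (elem∈ T p) }

  module Tops {Q m} (C : ChainColouring Q m) (T₀ : Antichain Q m)
              (onAntichain? : Decidable (OnAntichain Q m)) where

    Candidate : Fin m → A → Set (c ⊔ ℓ)
    Candidate i y = colour C y ≡ toℕ i × OnAntichain Q m y

    candidate? : ∀ i → Decidable (Candidate i)
    candidate? i y = colour C y ℕ.≟ toℕ i ×-dec onAntichain? y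

    candidates : Fin m → List A
    candidates i = filter (candidate? i) Q

    top-maximal : ∀ i → ∃ (Maximal (candidates i))
    top-maximal i with antichain-meets-colour C T₀ i
    ... | p , colour≡i = maximal (∈-filter⁺ (candidate? i) (elem∈ T₀ p) (colour≡i , T₀ , p , refl))

    top : Fin m → A
    top i = proj₁ (top-maximal i)

    top-candidate : ∀ i → top i ∈ Q × Candidate i (top i)
    top-candidate i = ∈-filter⁻ (candidate? i) {xs = Q} (proj₁ (proj₂ (top-maximal i)))

    top∈ : ∀ i → top i ∈ Q
    top∈ i = proj₁ (top-candidate i)

    colour-top : ∀ i → colour C (top i) ≡ toℕ i
    colour-top i = proj₁ (proj₂ (top-candidate i))

    top-onAntichain : ∀ i → OnAntichain Q m (top i)
    top-onAntichain i = proj₂ (proj₂ (top-candidate i))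

    below-top : ∀ {y} i → y ∈ Q → colour C y ≡ toℕ i → OnAntichain Q m y → y ≼ top i
    below-top {y} i y∈Q colour≡i y-on
      with monochromatic⇒comparable C y∈Q (top∈ i) (trans colour≡i (sym (colour-top i)))
    ... | inj₁ y≼top = y≼top
    ... | inj₂ top≼y = reflexive (proj₂ (proj₂ (top-maximal i))
                                   (∈-filter⁺ (candidate? i) y∈Q (colour≡i , y-on)) top≼y)

    antichain-below-top : (T : Antichain Q m) (i : Fin m) →
                          ∃ λ p → colour C (elem T p) ≡ toℕ i × elem T p ≼ top i
    antichain-below-top T i with antichain-meets-colour C T i
    ... | p , colour≡i = p , colour≡i , below-top i (elem∈ T p) colour≡i (T , p , refl)

    tops : Antichain Q m
    tops = record { elem = top ; elem∈ = top∈ ; incomparable = tops-incomparable }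
      where
      tops-incomparable : ∀ {i j} → i ≢ j → ¬ top i ≼ top j
      tops-incomparable {i} {j} i≢j topᵢ≼topⱼ with top-onAntichain j
      ... | T , q , Tq≡topⱼ with antichain-below-top T i
      ... | p , colour≡i , Tₚ≼topᵢ =
        incomparable T p≢q (subst (elem T p ≼_) (sym Tq≡topⱼ) (≼-trans Tₚ≼topᵢ topᵢ≼topⱼ))
        where
        p≢q : p ≢ q
        p≢q refl = i≢j (toℕ-injective (begin
          toℕ i              ≡⟨ colour≡i ⟨
          colour C (elem T p) ≡⟨ cong (colour C) Tq≡topⱼ ⟩
          colour C (top j)    ≡⟨ colour-top j ⟩
          toℕ j              ∎))
          where open ≡-Reasoning

  module Step {P : List A}
              (ih : ∀ {P'} → length P' < length P → ∀ m → AntichainOrChainCover P' m)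
              {a} (a-max : Maximal P a) where

    a∈P : a ∈ P
    a∈P = proj₁ a-max

    Q : List A
    Q = filter (∁? (_≟ a)) P

    Q-shorter : length Q < length P
    Q-shorter = filter-shorter (_≟ a) a∈P refl

    Q⊆P : ∀ {z} → z ∈ Q → z ∈ P
    Q⊆P = proj₁ ∘ ∈-filter⁻ (∁? (_≟ a))

    a⋠Q : ∀ {z} → z ∈ Q → ¬ a ≼ z
    a⋠Q z∈Q a≼z with ∈-filter⁻ (∁? (_≟ a)) z∈Q
    ... | z∈P , z≢a = z≢a (proj₂ a-max z∈P a≼z)

    antichain? : ∀ {L} → length L < length P → ∀ k → Dec (Antichain L k)
    antichain? _       zero    = yes emptyAntichain
    antichain? shorter (suc k) = [ yes , no ∘ colouring⇒¬antichain ]′ (ih shorter k)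

    onAntichainQ? : ∀ k → Decidable (OnAntichain Q (suc k))
    onAntichainQ? k = onAntichain? λ y →
      antichain? (ℕ.≤-<-trans (length-filter (incomparable? y) Q) Q-shorter) k

    module Galvin {m} (CQ : ChainColouring Q (suc m)) (B₀ : Antichain Q (suc m)) where
      open Tops CQ B₀ (onAntichainQ? m)

      Below : Fin (suc m) → A → Set (c ⊔ ℓ)
      Below i z = z ≡ a ⊎ (colour CQ z ≡ toℕ i × z ≼ top i)

      below? : ∀ i → Decidable (Below i)
      below? i z = (z ≟ a) ⊎-dec ((colour CQ z ℕ.≟ toℕ i) ×-dec (z ≼? top i))

      below-top∈Q : ∀ {i z} → z ∈ P → z ≼ top i → z ∈ Q
      below-top∈Q {i} z∈P z≼top = ∈-filter⁺ (∁? (_≟ a)) z∈P λ { refl → a⋠Q (top∈ i) z≼top }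

      below-chain : ∀ {i} → top i ≼ a → ∀ {x y} → x ∈ P → y ∈ P → Below i x → Below i y → Comparable x y
      below-chain _      _   _   (inj₁ refl)          (inj₁ refl)          = inj₁ ≼-refl
      below-chain topᵢ≼a _   _   (inj₁ refl)          (inj₂ (_ , y≼top))   = inj₂ (≼-trans y≼top topᵢ≼a)
      below-chain topᵢ≼a _   _   (inj₂ (_ , x≼top))   (inj₁ refl)          = inj₁ (≼-trans x≼top topᵢ≼a)
      below-chain _      x∈P y∈P (inj₂ (cx≡i , x≼top)) (inj₂ (cy≡i , y≼top)) =
        monochromatic⇒comparable CQ (below-top∈Q x∈P x≼top) (below-top∈Q y∈P y≼top) (trans cx≡i (sym cy≡i))

      without-below⊆Q : ∀ {i z} → z ∈ filter (∁? (below? i)) P → z ∈ Q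
      without-below⊆Q {i} z∈ with ∈-filter⁻ (∁? (below? i)) {xs = P} z∈
      ... | z∈P , ¬below = ∈-filter⁺ (∁? (_≟ a)) z∈P (¬below ∘ inj₁)

      ¬antichain-without-below : ∀ i → ¬ Antichain (filter (∁? (below? i)) P) (suc m)
      ¬antichain-without-below i S =
        let p , colour≡i , Sₚ≼top = antichain-below-top (antichain-mono without-below⊆Q S) i
        in proj₂ (∈-filter⁻ (∁? (below? i)) {xs = P} (elem∈ S p)) (inj₂ (colour≡i , Sₚ≼top))

      antichainOrChainCover : AntichainOrChainCover P (suc m)
      antichainOrChainCover with any? (λ i → top i ≼? a)
      ... | no none = inj₁ (antichain-cons a∈P (antichain-mono Q⊆P tops)
                              λ i → a⋠Q (top∈ i) , λ topᵢ≼a → none (i , topᵢ≼a))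
      ... | yes (i , topᵢ≼a) =
        [ ⊥-elim ∘ ¬antichain-without-below i , inj₂ ∘ add-chain (below? i) (below-chain topᵢ≼a) ]′
          (ih (filter-shorter (below? i) a∈P (inj₁ refl)) m)

    antichainOrChainCover : ∀ m → AntichainOrChainCover P m
    antichainOrChainCover zero    = inj₁ (singletonAntichain a∈P)
    antichainOrChainCover (suc m) with ih Q-shorter (suc m)
    ... | inj₁ S  = inj₁ (antichain-mono Q⊆P S)
    ... | inj₂ CQ with ih Q-shorter m
    ...   | inj₂ C′ = inj₂ (add-chain (_≟ a) (λ { _ _ refl refl → inj₁ ≼-refl }) C′)
    ...   | inj₁ B₀ = Galvin.antichainOrChainCover CQ B₀

  dilworth : ∀ P m → AntichainOrChainCover P m
  dilworth = All.wfRec (On.wellFounded length <-wellFounded) _ (λ P → ∀ m → AntichainOrChainCover P m) step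
    where
    step : ∀ P → (∀ {P'} → length P' < length P → ∀ m → AntichainOrChainCover P' m) →
           ∀ m → AntichainOrChainCover P m
    step []      _  _ = inj₂ (record { colour = λ _ → 0 ; colour< = λ () ; monochromatic⇒comparable = λ () })
    step (x ∷ L) ih   = Step.antichainOrChainCover ih (proj₂ (maximal-∷ x L))

⊆-isDecPartialOrder : ∀ n → IsDecPartialOrder _≡_ (_⊆_ {n})
⊆-isDecPartialOrder n = record { isPartialOrder = ⊆-isPartialOrder n ; _≟_ = ≡-dec Bool._≟_ ; _≤?_ = _⊆?_ }

⊈⇒nonempty-─ : ∀ {n} {p q : Subset n} → ¬ p ⊆ q → Nonempty (p ─ q)
⊈⇒nonempty-─ {p = p} {q} p⊈q with nonempty? (p ─ q)
... | yes p─q≢∅ = p─q≢∅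
... | no  p─q≡∅ = ⊥-elim (p⊈q p⊆q)
  where
  p⊆q : p ⊆ q
  p⊆q {x} x∈p = decidable-stable (x Subsetₚ.∈? q) λ x∉q → p─q≡∅ (x , x∈p∧x∉q⇒x∈p─q x∈p x∉q)

module ⊆-Dilworth {n} = Dilworth (⊆-isDecPartialOrder n)
open ⊆-Dilworth
open Antichain
open ChainColouring

antichain⇒weaklyCrossing : ∀ {n k} {F : List (Subset n)} →
                           Intersecting F → Antichain F k → HasWeaklyCrossingK k F
antichain⇒weaklyCrossing intersecting S = elem S , elem-injective S , elem∈ S , λ i j i≢j →
  intersecting _ _ (elem∈ S i) (elem∈ S j) ,
  ⊈⇒nonempty-─ (incomparable S i≢j) , ⊈⇒nonempty-─ (incomparable S (i≢j ∘ sym))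

colouring⇒partition : ∀ {n m} {F : List (Subset n)} → ChainColouring F m → PartitionIntoChains m F
colouring⇒partition C = colourᶠ C ∘ ∈-lookup , λ i j →
  monochromatic⇒comparable C (∈-lookup i) (∈-lookup j) ∘ colourᶠ≡⇒colour≡ C (∈-lookup i) (∈-lookup j)

-- Chains are assigned to positions of the list F.
lemma2p2 : (n k : ℕ) (F : List (Subset n)) → Unique F →
    WeaklyKCrossFree k F → Intersecting F → PartitionIntoChains (k ∸ 1) F
lemma2p2 n zero    F _ crossFree intersecting =
  ⊥-elim (crossFree (antichain⇒weaklyCrossing intersecting emptyAntichain))
lemma2p2 n (suc m) F _ crossFree intersecting =
  [ ⊥-elim ∘ crossFree ∘ antichain⇒weaklyCrossing intersecting , colouring⇒partition ]′ (dilworth F m)
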